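{- For every integer $i$, $\Delta_{\mathrm{desc}}\,\delta_i=(\mathrm{id}\odot\delta_i+\delta_i\otimes\mathrm{id})\,\Delta_{\mathrm{desc}}$ as linear maps $\mathcal H\to\mathcal H\otimes\mathcal H$.
   Context: Let $\{x_i\}_{i\ge1}$ be variables. For $k\ge1$, distinct $i_1,\dots,i_k\in\mathbb Z_{\ge1}$ and $(s_1,\dots,s_k)\in\mathbb Z_{\ge1}^k$, the Chen fraction is $\Phi^{s_1,\dots,s_k}_{i_1,\dots,i_k}:=\frac{1}{(x_{i_1}+\dots+x_{i_k})^{s_1}(x_{i_2}+\dots+x_{i_k})^{s_2}\cdots x_{i_k}^{s_k}}$. Let $F^{ch}$ be the set of Chen fractions together with $1$, and $\mathbb Q F^{ch}$ its span, in which $F^{ch}$ is a basis. Let $\partial_i:=-\frac{\partial}{\partial x_i}$, $d_{i,j}:=\partial_i-\partial_j$, and for indices $i_1,\dots,i_k$ set $d_{i_1,i_0}:=\partial_{i_1}$; operators act on tensors factorwise. $\Delta^{ch}$ is the linear map with $\Delta^{ch}(1)=1\otimes1$, $\Delta^{ch}(\Phi^{1,\dots,1}_{i_1,\dots,i_k})=\sum_{j=0}^k\Phi^{1,\dots,1}_{i_1,\dots,i_j}\otimes\Phi^{1,\dots,1}_{i_{j+1},\dots,i_k}$ (empty index list meaning $1$), and recursively $\Delta^{ch}(\Phi^{s_1,\dots,s_j+1,\dots,s_k}_{i_1,\dots,i_k})=\frac1{s_j}(\mathrm{id}\otimes d_{i_j,i_{j-1}}+d_{i_j,i_{j-1}}\otimes\mathrm{id})\Delta^{ch}(\Phi^{s_1,\dots,s_k}_{i_1,\dots,i_k})$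 (well defined). Let $\mathcal H$ be the $\mathbb Q$-vector space with basis a symbol $\mathbf 1$ and symbols $[\vec s]=[s_1,\dots,s_k]$, $k\ge1$, $s_j\in\mathbb Z_{\ge1}$, with depth $\operatorname{dep}(\vec s)=k$, $\operatorname{dep}(\mathbf 1)=0$; $\pi:\mathbb Q F^{ch}\to\mathcal H$ is linear with $\pi(1)=\mathbf 1$, $\pi(\Phi^{s_1,\dots,s_k}_{i_1,\dots,i_k})=[s_1,\dots,s_k]$. $\Delta_{\mathrm{desc}}:\mathcal H\to\mathcal H\otimes\mathcal H$ is linear with $\Delta_{\mathrm{desc}}(\mathbf 1)=\mathbf 1\otimes\mathbf 1$ and $\Delta_{\mathrm{desc}}([s_1,\dots,s_k])=(\pi\otimes\pi)\Delta^{ch}(\Phi^{s_1,\dots,s_k}_{i_1,\dots,i_k})$ for any pairwise distinct $i_1,\dots,i_k$ (independent of the choice). For $i\ge1$, $\delta_i:\mathcal H\to\mathcal H$ is linear with $\delta_i(\mathbf 1)=0$, $\delta_i[s_1,\dots,s_k]=\sum_{j=1}^i s_j[s_1,\dots,s_j+1,\dots,s_k]$ if $i\le k$ and $=0$ if $i>k$; $\delta_i:=0$ for $i\le0$. The shifted tensor $\mathrm{id}\odot\delta_i$ is the linear map $[\vec s]\otimes[\vec t]\mapsto[\vec s]\otimes\delta_{i-\operatorname{dep}(\vec s)}([\vec t])$ on basis elements (including $\mathbf 1$). -}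

module Defs where

open import Data.Nat as ℕ using (ℕ; zero; suc)
open import Data.Integer as ℤ using (ℤ; +_; -[1+_])
open import Data.Rational as ℚ using (ℚ; 0ℚ; 1ℚ)
open import Data.List using (List; []; _∷_; _++_; map; concatMap; length; upTo; zip; foldr)
open import Data.List.Properties using () renaming (≡-dec to List-≡-dec)
open import Data.Product using (_×_; _,_; proj₁; proj₂)
open import Data.Product.Properties using () renaming (≡-dec to ×-≡-dec)
open import Data.Maybe using (Maybe; just; nothing)
open import Data.Bool using (Bool; true; false; if_then_else_)
open import Relation.Nullary using (does)
open import Relation.Binary.PropositionalEquality using (_≡_)
open import Relation.Binary.Definitions using (DecidableEquality)

-- Finite formal ℚ-linear combinations over a basis B
-- (an element is a list of (coefficient , basis element) pairs)

Lin : Set → Set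
Lin B = List (ℚ × B)

zeroL : ∀ {B} → Lin B
zeroL = []

_+L_ : ∀ {B} → Lin B → Lin B → Lin B
u +L v = u ++ v

scaleL : ∀ {B} → ℚ → Lin B → Lin B
scaleL c = map (λ p → (c ℚ.* proj₁ p , proj₂ p))

negL : ∀ {B} → Lin B → Lin B
negL = scaleL (ℚ.- 1ℚ)

ext : ∀ {A B} → (A → Lin B) → Lin A → Lin B
ext f = concatMap (λ p → scaleL (proj₁ p) (f (proj₂ p)))

coeff : ∀ {B} → DecidableEquality B → B → Lin B → ℚ
coeff _≟_ b [] = 0ℚ
coeff _≟_ b ((c , b') ∷ u) =
  (if does (b ≟ b') then c else 0ℚ) ℚ.+ coeff _≟_ b u

_≈⟨_⟩_ : ∀ {B} → Lin B → DecidableEquality B → Lin B → Set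
u ≈⟨ _≟_ ⟩ v = ∀ b → coeff _≟_ b u ≡ coeff _≟_ b v

_⊗L_ : ∀ {A B} → (A → Lin A) → (B → Lin B) → (A × B) → Lin (A × B)
(f ⊗L g) (a , b) =
  concatMap (λ p → map (λ q → (proj₁ p ℚ.* proj₁ q , (proj₂ p , proj₂ q))) (g b)) (f a)

idL : ∀ {A} → A → Lin A
idL a = (1ℚ , a) ∷ []

-- A Chen fraction Φ^{s_1..s_k}_{i_1..i_k} is encoded by the list
-- ((i_1 , e_1) ∷ ... ∷ (i_k , e_k)) with s_j = suc e_j;
-- the empty list encodes the constant 1.
-- ℚF^ch is the free ℚ-vector space on F^ch (F^ch is a basis of it).

ChenB : Set
ChenB = List (ℕ × ℕ)

ChenB-≟ : DecidableEquality ChenB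
ChenB-≟ = List-≡-dec (×-≡-dec ℕ._≟_ ℕ._≟_)

memb : ℕ → List (ℕ × ℕ) → Bool
memb i [] = false
memb i ((a , _) ∷ ps) = if does (i ℕ.≟ a) then true else memb i ps

-- ∂_i = - ∂/∂x_i on a Chen fraction:
--  -∂/∂x_i (x_{i_j}+...+x_{i_k})^{-s_j} = s_j (x_{i_j}+...+x_{i_k})^{-(s_j+1)}
--  if i ∈ {i_j,...,i_k}, and 0 otherwise; product rule over j.
∂B : ℕ → ChenB → Lin ChenB
∂B i [] = []
∂B i ((a , e) ∷ ps) =
  (if memb i ((a , e) ∷ ps)
     then ((+ suc e ℚ./ 1) , ((a , suc e) ∷ ps)) ∷ []
     else [])
  ++ map (λ p → (proj₁ p , (a , e) ∷ proj₂ p)) (∂B i ps)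

∂ : ℕ → Lin ChenB → Lin ChenB
∂ i = ext (∂B i)

-- d_{i,j} = ∂_i - ∂_j, and d_{i_1,i_0} := ∂_{i_1} (previous index absent)
d : ℕ → Maybe ℕ → Lin ChenB → Lin ChenB
d i nothing  u = ∂ i u
d i (just j) u = ∂ i u +L negL (∂ j u)

idL⊗_ : (Lin ChenB → Lin ChenB) → Lin (ChenB × ChenB) → Lin (ChenB × ChenB)
(idL⊗ D) = ext (λ ab → (idL ⊗L (λ b → D (idL b))) ab)

_⊗idL : (Lin ChenB → Lin ChenB) → Lin (ChenB × ChenB) → Lin (ChenB × ChenB)
(D ⊗idL) = ext (λ ab → ((λ a → D (idL a)) ⊗L idL) ab)

-- deconcatenation coproduct on Φ^{1,...,1}_{i_1..i_k} (and on 1)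
deconc : ChenB → Lin (ChenB × ChenB)
deconc [] = (1ℚ , ([] , [])) ∷ []
deconc (p ∷ ps) =
  (1ℚ , ([] , p ∷ ps)) ∷ map (λ q → (proj₁ q , (p ∷ proj₁ (proj₂ q) , proj₂ (proj₂ q)))) (deconc ps)

-- Find the first position j with s_j > 1 (i.e. e_j = suc e').
-- Returns (i_{j-1} if j>1, i_j, s_j - 1 written as suc e', list with s_j lowered by 1).
record Lowered : Set where
  constructor lowered
  field
    prevIdx : Maybe ℕ
    idx     : ℕ
    sPrev   : ℕ          -- the lowered exponent s_j - 1 = suc e' (≥ 1), stored as e'
    rest    : ChenB

lowerFirst : Maybe ℕ → ChenB → Maybe Lowered
lowerFirst prev [] = nothing
lowerFirst prev ((a , zero) ∷ ps) with lowerFirst (just a) ps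
... | nothing = nothing
... | just (lowered p i s r) = just (lowered p i s ((a , zero) ∷ r))
lowerFirst prev ((a , suc e) ∷ ps) = just (lowered prev a e ((a , e) ∷ ps))

sumE : ChenB → ℕ
sumE = foldr (λ p n → proj₂ p ℕ.+ n) 0

-- Δ^ch via the defining recursion (fuel = total excess exponent, which
-- decreases by exactly one at each recursive step):
--  Δ^ch(Φ^{..,s_j+1,..}) = 1/s_j (id ⊗ d_{i_j,i_{j-1}} + d_{i_j,i_{j-1}} ⊗ id) Δ^ch(Φ^{..,s_j,..})
-- always lowering the first exponent > 1 (the result is independent of this
-- choice, as stated in the context).
Δch-go : ℕ → ChenB → Lin (ChenB × ChenB)
Δch-go zero ps = deconc ps
Δch-go (suc n) ps with lowerFirst nothing ps
... | nothing = deconc ps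
... | just (lowered p i e r) =
  scaleL (+ 1 ℚ./ suc e)
    ((idL⊗ d i p) (Δch-go n r) +L (d i p ⊗idL) (Δch-go n r))

Δch : ChenB → Lin (ChenB × ChenB)
Δch ps = Δch-go (sumE ps) ps

-- The space 𝓗: basis symbols [s_1,...,s_k] (k ≥ 1, s_j ≥ 1) and 𝟏.
-- A basis symbol is encoded as a list (e_1 ∷ ... ∷ e_k) with s_j = suc e_j;
-- the empty list encodes 𝟏.  dep = length.

HB : Set
HB = List ℕ

HB-≟ : DecidableEquality HB
HB-≟ = List-≡-dec ℕ._≟_

HB2-≟ : DecidableEquality (HB × HB)
HB2-≟ = ×-≡-dec HB-≟ HB-≟

𝓗 : Set
𝓗 = Lin HB

𝓗⊗𝓗 : Set
𝓗⊗𝓗 = Lin (HB × HB)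

dep : HB → ℕ
dep = length

πB : ChenB → HB
πB = map proj₂

π⊗π : Lin (ChenB × ChenB) → 𝓗⊗𝓗
π⊗π = map (λ q → (proj₁ q , (πB (proj₁ (proj₂ q)) , πB (proj₂ (proj₂ q)))))

-- Δ_desc, computed with the pairwise distinct indices i_j = j
ΔdescB : HB → 𝓗⊗𝓗
ΔdescB es = π⊗π (Δch (zip (map suc (upTo (length es))) es))

Δdesc : 𝓗 → 𝓗⊗𝓗
Δdesc = ext ΔdescB

-- δ_i for i ≥ 0 (natural number argument):
-- δ_n [s_1..s_k] = Σ_{j=1}^{n} s_j [s_1,..,s_j+1,..,s_k] if n ≤ k, 0 if n > k
δℕ-sum : ℕ → HB → 𝓗
δℕ-sum zero es = []
δℕ-sum (suc n) [] = []
δℕ-sum (suc n) (e ∷ es) =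
  ((+ suc e ℚ./ 1) , suc e ∷ es) ∷ map (λ q → (proj₁ q , e ∷ proj₂ q)) (δℕ-sum n es)

δℕB : ℕ → HB → 𝓗
δℕB n es = if does (n ℕ.≤? length es) then δℕ-sum n es else []

δB : ℤ → HB → 𝓗
δB (+ n) es = δℕB n es
δB -[1+ n ] es = []

δ : ℤ → 𝓗 → 𝓗
δ i = ext (δB i)

-- id ⊙ δ_i : [s] ⊗ [t] ↦ [s] ⊗ δ_{i - dep s}[t]
id⊙δ : ℤ → 𝓗⊗𝓗 → 𝓗⊗𝓗
id⊙δ i = ext (λ st → map (λ q → (proj₁ q , (proj₁ st , proj₂ q)))
                           (δB (i ℤ.- + dep (proj₁ st)) (proj₂ st)))

δ⊗id : ℤ → 𝓗⊗𝓗 → 𝓗⊗𝓗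
δ⊗id i = ext (λ st → map (λ q → (proj₁ q , (proj₂ q , proj₂ st))) (δB i (proj₁ st)))

{-# OPTIONS --safe #-}
module Submission where

-- Every identity is tested against functions: two formal combinations have the same
-- coefficients iff they have the same pairing ⟪ u , g ⟫ = Σ c · g b with every g, so each
-- linear operator may be replaced by its dual acting on test functions.
--
-- The operators d_{i,j} = ∂_i − ∂_j commute, so two different lowerings of exponents of a
-- Chen fraction can be completed to a common one; hence the recursion defining Δ^ch may
-- lower ANY exponent s_j > 1, not only the first. Consequently, for Φ with indices 1, …, k,
--   Δ^ch ∂_m Φ = Σ_{j ≤ m} s_j Δ^ch Φ^{…, s_j + 1, …} = Σ_{j ≤ m} (id ⊗ d_{j,j−1} + d_{j,j−1} ⊗ id) Δ^ch Φ,
-- which telescopes to (id ⊗ ∂_m + ∂_m ⊗ id) Δ^ch Φ. With indices 1, …, k, π turns ∂_m Φ into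
-- δ_m [s], and on a term Φ_{1..j} ⊗ Φ_{j+1..k} of Δ^ch it turns ∂_m ⊗ id into δ_m ⊗ id and
-- id ⊗ ∂_m into id ⊗ δ_{m−j}.

open import Defs
open import Data.Integer using (ℤ)
open import Data.Nat as ℕ using (ℕ; zero; suc)
open import Data.Integer as ℤ using (+_; -[1+_])
open import Data.Rational as ℚ using (ℚ; 0ℚ; 1ℚ; _+_; _*_; _-_; mkℚ)
import Data.Rational.Properties as QP
import Data.Nat.Properties as NP
import Data.Nat.Coprimality as Coprime
import Data.Integer.Properties as ZP
import Data.List.Properties as LP
open import Data.Rational.Solver using (module +-*-Solver)
open +-*-Solver
open import Data.List using (List; []; _∷_; _++_; map; concatMap; length; zip; applyUpTo; upTo)
open import Data.Product using (_×_; _,_; proj₁; proj₂; ∃)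
open import Data.Sum using (_⊎_; inj₁; inj₂)
open import Data.Maybe using (Maybe; just; nothing)
open import Data.Bool using (Bool; true; false; if_then_else_)
open import Function using (_∘_; case_of_)
open import Relation.Nullary using (does; yes; no; Dec)
open import Relation.Nullary.Decidable using (dec-true; dec-false)
open import Relation.Binary.PropositionalEquality
open import Relation.Binary.Definitions using (DecidableEquality)
open ≡-Reasoning

-- Pairing with test functions, and dual operators

mapL : ∀ {A B : Set} → (A → B) → Lin A → Lin B
mapL f = map (λ p → (proj₁ p , f (proj₂ p)))

⟪_,_⟫ : ∀ {B : Set} → Lin B → (B → ℚ) → ℚ
⟪ [] , g ⟫ = 0ℚ
⟪ (c , b) ∷ u , g ⟫ = c * g b + ⟪ u , g ⟫

module _ {B : Set} where

  pairing-++ : (u v : Lin B) (g : B → ℚ) → ⟪ u ++ v , g ⟫ ≡ ⟪ u , g ⟫ + ⟪ v , g ⟫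
  pairing-++ [] v g = sym (QP.+-identityˡ _)
  pairing-++ ((c , b) ∷ u) v g =
    trans (cong (_+_ (c * g b)) (pairing-++ u v g)) (sym (QP.+-assoc (c * g b) ⟪ u , g ⟫ ⟪ v , g ⟫))

  pairing-scaleL : (c : ℚ) (u : Lin B) (g : B → ℚ) → ⟪ scaleL c u , g ⟫ ≡ c * ⟪ u , g ⟫
  pairing-scaleL c [] g = sym (QP.*-zeroʳ c)
  pairing-scaleL c ((a , b) ∷ u) g = trans (cong (_+_ ((c * a) * g b)) (pairing-scaleL c u g))
    (solve 4 (λ c a x y → (c :* a) :* x :+ c :* y := c :* (a :* x :+ y)) refl c a (g b) ⟪ u , g ⟫)

  pairing-map : ∀ {A : Set} (f : A → B) (u : Lin A) (g : B → ℚ) → ⟪ mapL f u , g ⟫ ≡ ⟪ u , g ∘ f ⟫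
  pairing-map f [] g = refl
  pairing-map f ((c , a) ∷ u) g = cong (_+_ (c * g (f a))) (pairing-map f u g)

  pairing-cong : (u : Lin B) {g h : B → ℚ} → (∀ b → g b ≡ h b) → ⟪ u , g ⟫ ≡ ⟪ u , h ⟫
  pairing-cong [] e = refl
  pairing-cong ((c , b) ∷ u) e = cong₂ (λ x y → c * x + y) (e b) (pairing-cong u e)

  pairing-+ : (u : Lin B) (g h : B → ℚ) → ⟪ u , (λ b → g b + h b) ⟫ ≡ ⟪ u , g ⟫ + ⟪ u , h ⟫
  pairing-+ [] g h = sym (QP.+-identityˡ _)
  pairing-+ ((c , b) ∷ u) g h = trans (cong (_+_ (c * (g b + h b))) (pairing-+ u g h))
    (solve 5 (λ c x y p q → c :* (x :+ y) :+ (p :+ q) := (c :* x :+ p) :+ (c :* y :+ q))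
       refl c (g b) (h b) ⟪ u , g ⟫ ⟪ u , h ⟫)

  pairing-- : (u : Lin B) (g h : B → ℚ) → ⟪ u , (λ b → g b - h b) ⟫ ≡ ⟪ u , g ⟫ - ⟪ u , h ⟫
  pairing-- [] g h = refl
  pairing-- ((c , b) ∷ u) g h = trans (cong (_+_ (c * (g b - h b))) (pairing-- u g h))
    (solve 5 (λ c x y p q → c :* (x :- y) :+ (p :- q) := (c :* x :+ p) :- (c :* y :+ q))
       refl c (g b) (h b) ⟪ u , g ⟫ ⟪ u , h ⟫)

  pairing-* : (u : Lin B) (c : ℚ) (g : B → ℚ) → ⟪ u , (λ b → c * g b) ⟫ ≡ c * ⟪ u , g ⟫
  pairing-* [] c g = sym (QP.*-zeroʳ c)
  pairing-* ((a , b) ∷ u) c g = trans (cong (_+_ (a * (c * g b))) (pairing-* u c g))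
    (solve 4 (λ c a x y → a :* (c :* x) :+ c :* y := c :* (a :* x :+ y)) refl c a (g b) ⟪ u , g ⟫)

  pairing-0 : (u : Lin B) → ⟪ u , (λ _ → 0ℚ) ⟫ ≡ 0ℚ
  pairing-0 [] = refl
  pairing-0 ((c , b) ∷ u) = trans (cong (_+_ (c * 0ℚ)) (pairing-0 u))
    (solve 1 (λ c → c :* con 0ℚ :+ con 0ℚ := con 0ℚ) refl c)

pairing-ext : ∀ {A B : Set} (f : A → Lin B) (u : Lin A) (g : B → ℚ) →
  ⟪ ext f u , g ⟫ ≡ ⟪ u , (λ a → ⟪ f a , g ⟫) ⟫
pairing-ext f [] g = refl
pairing-ext f ((c , a) ∷ u) g = trans (pairing-++ (scaleL c (f a)) (ext f u) g)
  (cong₂ _+_ (pairing-scaleL c (f a) g) (pairing-ext f u g))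

pairing-interchange : ∀ {A B : Set} (u : Lin A) (v : Lin B) (h : A → B → ℚ) →
  ⟪ u , (λ a → ⟪ v , h a ⟫) ⟫ ≡ ⟪ v , (λ b → ⟪ u , (λ a → h a b) ⟫) ⟫
pairing-interchange [] v h = sym (pairing-0 v)
pairing-interchange ((c , a) ∷ u) v h = begin
  c * ⟪ v , h a ⟫ + ⟪ u , (λ a → ⟪ v , h a ⟫) ⟫
    ≡⟨ cong₂ _+_ (sym (pairing-* v c (h a))) (pairing-interchange u v h) ⟩
  ⟪ v , (λ b → c * h a b) ⟫ + ⟪ v , (λ b → ⟪ u , (λ a → h a b) ⟫) ⟫
    ≡⟨ sym (pairing-+ v _ _) ⟩
  ⟪ v , (λ b → c * h a b + ⟪ u , (λ a → h a b) ⟫) ⟫ ∎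

pairing-⊗L : ∀ {A B : Set} (F : A → Lin A) (G : B → Lin B) (a : A) (b : B) (g : A × B → ℚ) →
  ⟪ (F ⊗L G) (a , b) , g ⟫ ≡ ⟪ F a , (λ a' → ⟪ G b , (λ b' → g (a' , b')) ⟫) ⟫
pairing-⊗L {A} {B} F G a b g = go (F a)
  where
  row : (c : ℚ) (a' : A) (v : Lin B) →
    ⟪ map (λ q → (c * proj₁ q , (a' , proj₂ q))) v , g ⟫ ≡ c * ⟪ v , (λ b' → g (a' , b')) ⟫
  row c a' [] = sym (QP.*-zeroʳ c)
  row c a' ((e , b') ∷ v) = trans (cong (_+_ ((c * e) * g (a' , b'))) (row c a' v))
    (solve 4 (λ c a x y → (c :* a) :* x :+ c :* y := c :* (a :* x :+ y)) refl c e (g (a' , b')) _)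
  go : (u : Lin A) →
    ⟪ concatMap (λ p → map (λ q → (proj₁ p * proj₁ q , (proj₂ p , proj₂ q))) (G b)) u , g ⟫
      ≡ ⟪ u , (λ a' → ⟪ G b , (λ b' → g (a' , b')) ⟫) ⟫
  go [] = refl
  go ((c , a') ∷ u) = trans (pairing-++ (map (λ q → (c * proj₁ q , (a' , proj₂ q))) (G b)) _ g)
    (cong₂ _+_ (row c a' (G b)) (go u))

coeff≡pairing : ∀ {B : Set} (_≟_ : DecidableEquality B) (b : B) (u : Lin B) →
  coeff _≟_ b u ≡ ⟪ u , (λ b' → if does (b ≟ b') then 1ℚ else 0ℚ) ⟫
coeff≡pairing _≟_ b [] = refl
coeff≡pairing _≟_ b ((c , b') ∷ u) with does (b ≟ b')
... | true  = cong₂ _+_ (sym (QP.*-identityʳ c)) (coeff≡pairing _≟_ b u)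
... | false = cong₂ _+_ (sym (QP.*-zeroʳ c)) (coeff≡pairing _≟_ b u)

_≋_ : ∀ {B : Set} → Lin B → Lin B → Set
u ≋ v = ∀ g → ⟪ u , g ⟫ ≡ ⟪ v , g ⟫

≋⇒≈ : ∀ {B : Set} (_≟_ : DecidableEquality B) {u v : Lin B} → u ≋ v → u ≈⟨ _≟_ ⟩ v
≋⇒≈ _≟_ {u} {v} u≋v b = trans (coeff≡pairing _≟_ b u) (trans (u≋v _) (sym (coeff≡pairing _≟_ b v)))

dual : ∀ {B : Set} → (B → Lin B) → (B → ℚ) → B → ℚ
dual L h x = ⟪ L x , h ⟫

Commute : ∀ {B : Set} → (B → Lin B) → (B → Lin B) → Set
Commute L M = ∀ h x → dual L (dual M h) x ≡ dual M (dual L h) x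

module _ {B : Set} where

  Commute-sym : {L M : B → Lin B} → Commute L M → Commute M L
  Commute-sym L∘M h x = sym (L∘M h x)

  Commute-zeroˡ : (M : B → Lin B) → Commute (λ _ → []) M
  Commute-zeroˡ M h x = sym (pairing-0 (M x))

  Commute-difference : {L A C M : B → Lin B} →
    (∀ h x → dual L h x ≡ dual A h x - dual C h x) →
    Commute A M → Commute C M → Commute L M
  Commute-difference {L} {A} {C} {M} L≡A-C A∘M C∘M h x = begin
    dual L (dual M h) x                       ≡⟨ L≡A-C _ x ⟩
    dual A (dual M h) x - dual C (dual M h) x ≡⟨ cong₂ _-_ (A∘M h x) (C∘M h x) ⟩
    dual M (dual A h) x - dual M (dual C h) x ≡⟨ sym (pairing-- (M x) _ _) ⟩
    ⟪ M x , (λ y → dual A h y - dual C h y) ⟫ ≡⟨ pairing-cong (M x) (λ y → sym (L≡A-C h y)) ⟩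
    dual M (dual L h) x                       ∎

  dual⊗ : (B → Lin B) → (B × B → ℚ) → B × B → ℚ
  dual⊗ L g (a , b) = dual L (λ b' → g (a , b')) b + dual L (λ a' → g (a' , b)) a

  dual⊗-commute : (L M : B → Lin B) → Commute L M → ∀ g ab → dual⊗ L (dual⊗ M g) ab ≡ dual⊗ M (dual⊗ L g) ab
  dual⊗-commute L M L∘M g (a , b) = begin
    dual⊗ L (dual⊗ M g) (a , b) ≡⟨ cong₂ _+_ (pairing-+ (L b) _ _) (pairing-+ (L a) _ _) ⟩
    (A1 + X1) + (X2 + A2)
      ≡⟨ cong₂ _+_ (cong₂ _+_ (L∘M _ b) (pairing-interchange (L b) (M a) (λ b' a' → g (a' , b'))))
                   (cong₂ _+_ (sym (pairing-interchange (M b) (L a) (λ b' a' → g (a' , b')))) (L∘M _ a)) ⟩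
    (B1 + Y2) + (Y1 + B2)
      ≡⟨ solve 4 (λ p q r s → (p :+ q) :+ (r :+ s) := (p :+ r) :+ (q :+ s)) refl B1 Y2 Y1 B2 ⟩
    (B1 + Y1) + (Y2 + B2) ≡⟨ sym (cong₂ _+_ (pairing-+ (M b) _ _) (pairing-+ (M a) _ _)) ⟩
    dual⊗ M (dual⊗ L g) (a , b) ∎
    where
    A1 = dual L (dual M (λ b' → g (a , b'))) b
    X1 = dual L (λ b' → dual M (λ a' → g (a' , b')) a) b
    X2 = dual L (λ a' → dual M (λ b' → g (a' , b')) b) a
    A2 = dual L (dual M (λ a' → g (a' , b))) a
    B1 = dual M (dual L (λ b' → g (a , b'))) b
    Y1 = dual M (λ b' → dual L (λ a' → g (a' , b')) a) b
    Y2 = dual M (λ a' → dual L (λ b' → g (a' , b')) b) a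
    B2 = dual M (dual L (λ a' → g (a' , b))) a

  dual⊗-difference : {L A C : B → Lin B} → (∀ h x → dual L h x ≡ dual A h x - dual C h x) →
    ∀ g ab → dual⊗ L g ab ≡ dual⊗ A g ab - dual⊗ C g ab
  dual⊗-difference {L} {A} {C} L≡A-C g (a , b) = trans (cong₂ _+_ (L≡A-C _ b) (L≡A-C _ a))
    (solve 4 (λ p q r s → (p :- q) :+ (r :- s) := (p :+ r) :- (q :+ s)) refl
       (dual A (λ b' → g (a , b')) b) (dual C (λ b' → g (a , b')) b)
       (dual A (λ a' → g (a' , b)) a) (dual C (λ a' → g (a' , b)) a))

-- Commutation of the derivations ∂_i and d_{i,j}

χ : Bool → ℚ
χ true  = 1ℚ
χ false = 0ℚ

indices : ChenB → List ℕ
indices = map proj₁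

memb-cong-indices : ∀ i {ps qs} → indices ps ≡ indices qs → memb i ps ≡ memb i qs
memb-cong-indices i {[]} {[]} _ = refl
memb-cong-indices i {(a , _) ∷ ps} {(b , _) ∷ qs} eq with LP.∷-injective eq
... | refl , eq' = cong (if does (i ℕ.≟ a) then true else_) (memb-cong-indices i eq')

∂ᵀ : ℕ → (ChenB → ℚ) → ChenB → ℚ
∂ᵀ i = dual (∂B i)

∂ᵀ-∷ : ∀ i h a e ps → ∂ᵀ i h ((a , e) ∷ ps) ≡
  χ (memb i ((a , e) ∷ ps)) * ((+ suc e ℚ./ 1) * h ((a , suc e) ∷ ps)) + ∂ᵀ i (λ qs → h ((a , e) ∷ qs)) ps
∂ᵀ-∷ i h a e ps = trans (pairing-++ (raised (memb i ((a , e) ∷ ps))) _ h)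
  (cong₂ _+_ (pairing-raised (memb i ((a , e) ∷ ps))) (pairing-map ((a , e) ∷_) (∂B i ps) h))
  where
  raised : Bool → Lin ChenB
  raised b = if b then ((+ suc e ℚ./ 1) , ((a , suc e) ∷ ps)) ∷ [] else []
  pairing-raised : ∀ b → ⟪ raised b , h ⟫ ≡ χ b * ((+ suc e ℚ./ 1) * h ((a , suc e) ∷ ps))
  pairing-raised true  = solve 1 (λ x → x :+ con 0ℚ := con 1ℚ :* x) refl ((+ suc e ℚ./ 1) * h ((a , suc e) ∷ ps))
  pairing-raised false = sym (QP.*-zeroˡ ((+ suc e ℚ./ 1) * h ((a , suc e) ∷ ps)))

∂ᵀ-cong-indices : ∀ i ps {h h'} → (∀ qs → indices qs ≡ indices ps → h qs ≡ h' qs) → ∂ᵀ i h ps ≡ ∂ᵀ i h' ps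
∂ᵀ-cong-indices i [] e = refl
∂ᵀ-cong-indices i ((a , x) ∷ ps) {h} {h'} e = begin
  ∂ᵀ i h ((a , x) ∷ ps) ≡⟨ ∂ᵀ-∷ i h a x ps ⟩
  _ ≡⟨ cong₂ (λ u v → χ (memb i ((a , x) ∷ ps)) * ((+ suc x ℚ./ 1) * u) + v) (e _ refl)
       (∂ᵀ-cong-indices i ps (λ qs eq → e _ (cong (a ∷_) eq))) ⟩
  _ ≡⟨ sym (∂ᵀ-∷ i h' a x ps) ⟩
  ∂ᵀ i h' ((a , x) ∷ ps) ∎

∂ᵀ∂ᵀ-∷ : ∀ a b h x e ps → ∂ᵀ a (∂ᵀ b h) ((x , e) ∷ ps) ≡
  χ (memb a ((x , e) ∷ ps)) * ((+ suc e ℚ./ 1) *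
     (χ (memb b ((x , e) ∷ ps)) * ((+ suc (suc e) ℚ./ 1) * h ((x , suc (suc e)) ∷ ps))
      + ∂ᵀ b (λ qs → h ((x , suc e) ∷ qs)) ps))
  + (χ (memb b ((x , e) ∷ ps)) * ((+ suc e ℚ./ 1) * ∂ᵀ a (λ qs → h ((x , suc e) ∷ qs)) ps)
     + ∂ᵀ a (∂ᵀ b (λ qs → h ((x , e) ∷ qs))) ps)
∂ᵀ∂ᵀ-∷ a b h x e ps = begin
  ∂ᵀ a (∂ᵀ b h) ((x , e) ∷ ps) ≡⟨ ∂ᵀ-∷ a (∂ᵀ b h) x e ps ⟩
  χa * (s * ∂ᵀ b h ((x , suc e) ∷ ps)) + ∂ᵀ a (λ qs → ∂ᵀ b h ((x , e) ∷ qs)) ps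
    ≡⟨ cong₂ (λ u v → χa * (s * u) + v) (∂ᵀ-∷ b h x (suc e) ps) tail ⟩
  _ ∎
  where
  χa = χ (memb a ((x , e) ∷ ps))
  χb = χ (memb b ((x , e) ∷ ps))
  s  = + suc e ℚ./ 1
  h₁ = λ qs → h ((x , suc e) ∷ qs)
  h₀ = λ qs → h ((x , e) ∷ qs)
  tail : ∂ᵀ a (λ qs → ∂ᵀ b h ((x , e) ∷ qs)) ps ≡ χb * (s * ∂ᵀ a h₁ ps) + ∂ᵀ a (∂ᵀ b h₀) ps
  tail = begin
    ∂ᵀ a (λ qs → ∂ᵀ b h ((x , e) ∷ qs)) ps
      ≡⟨ ∂ᵀ-cong-indices a ps (λ qs eq → trans (∂ᵀ-∷ b h x e qs)
           (cong (λ m → χ m * (s * h₁ qs) + ∂ᵀ b h₀ qs) (memb-cong-indices b {(x , e) ∷ qs} {(x , e) ∷ ps} (cong (x ∷_) eq)))) ⟩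
    ∂ᵀ a (λ qs → χb * (s * h₁ qs) + ∂ᵀ b h₀ qs) ps
      ≡⟨ pairing-+ (∂B a ps) _ _ ⟩
    ∂ᵀ a (λ qs → χb * (s * h₁ qs)) ps + ∂ᵀ a (∂ᵀ b h₀) ps
      ≡⟨ cong (_+ ∂ᵀ a (∂ᵀ b h₀) ps) (trans (pairing-* (∂B a ps) χb _) (cong (χb *_) (pairing-* (∂B a ps) s h₁))) ⟩
    χb * (s * ∂ᵀ a h₁ ps) + ∂ᵀ a (∂ᵀ b h₀) ps ∎

∂-commute : ∀ a b → Commute (∂B a) (∂B b)
∂-commute a b h [] = refl
∂-commute a b h ((x , e) ∷ ps) = begin
  ∂ᵀ a (∂ᵀ b h) ((x , e) ∷ ps) ≡⟨ ∂ᵀ∂ᵀ-∷ a b h x e ps ⟩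
  _ ≡⟨ cong (λ v → χa * (s * (χb * (s' * G) + P)) + (χb * (s * Q) + v)) (∂-commute a b _ ps) ⟩
  _ ≡⟨ solve 8 (λ χa χb s s' G P Q R → χa :* (s :* (χb :* (s' :* G) :+ P)) :+ (χb :* (s :* Q) :+ R)
                := χb :* (s :* (χa :* (s' :* G) :+ Q)) :+ (χa :* (s :* P) :+ R)) refl χa χb s s' G P Q _ ⟩
  _ ≡⟨ sym (∂ᵀ∂ᵀ-∷ b a h x e ps) ⟩
  ∂ᵀ b (∂ᵀ a h) ((x , e) ∷ ps) ∎
  where
  χa = χ (memb a ((x , e) ∷ ps))
  χb = χ (memb b ((x , e) ∷ ps))
  s  = + suc e ℚ./ 1
  s' = + suc (suc e) ℚ./ 1
  G  = h ((x , suc (suc e)) ∷ ps)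
  P  = ∂ᵀ b (λ qs → h ((x , suc e) ∷ qs)) ps
  Q  = ∂ᵀ a (λ qs → h ((x , suc e) ∷ qs)) ps

dᴮ : ℕ → Maybe ℕ → ChenB → Lin ChenB
dᴮ i p x = d i p (idL x)

prevᴮ : Maybe ℕ → ChenB → Lin ChenB
prevᴮ nothing  _ = []
prevᴮ (just j) x = ∂B j x

dual-dᴮ : ∀ i p h x → dual (dᴮ i p) h x ≡ ∂ᵀ i h x - dual (prevᴮ p) h x
dual-dᴮ i nothing h x = trans (pairing-∂-idL i) (solve 1 (λ a → a := a :- con 0ℚ) refl (∂ᵀ i h x))
  where
  pairing-∂-idL : ∀ i → ⟪ ∂ i (idL x) , h ⟫ ≡ ∂ᵀ i h x
  pairing-∂-idL i = trans (pairing-ext (∂B i) (idL x) h) (solve 1 (λ a → con 1ℚ :* a :+ con 0ℚ := a) refl (∂ᵀ i h x))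
dual-dᴮ i (just j) h x = begin
  ⟪ ∂ i (idL x) ++ negL (∂ j (idL x)) , h ⟫ ≡⟨ pairing-++ (∂ i (idL x)) _ h ⟩
  _ ≡⟨ cong₂ _+_ (dual-dᴮ i nothing h x) (trans (pairing-scaleL (ℚ.- 1ℚ) (∂ j (idL x)) h) (cong ((ℚ.- 1ℚ) *_) (dual-dᴮ j nothing h x))) ⟩
  _ ≡⟨ solve 2 (λ a b → (a :- con 0ℚ) :+ (:- con 1ℚ) :* (b :- con 0ℚ) := a :- b) refl (∂ᵀ i h x) (∂ᵀ j h x) ⟩
  _ ∎

dᴮ-commute-∂ : ∀ i p b → Commute (dᴮ i p) (∂B b)
dᴮ-commute-∂ i p b = Commute-difference {L = dᴮ i p} {∂B i} {prevᴮ p} {∂B b} (dual-dᴮ i p) (∂-commute i b) (prev-commute p)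
  where
  prev-commute : ∀ p → Commute (prevᴮ p) (∂B b)
  prev-commute nothing  = Commute-zeroˡ (∂B b)
  prev-commute (just j) = ∂-commute j b

dᴮ-commute : ∀ i p i' p' → Commute (dᴮ i p) (dᴮ i' p')
dᴮ-commute i p i' p' = Commute-difference {L = dᴮ i p} {∂B i} {prevᴮ p} {dᴮ i' p'} (dual-dᴮ i p)
  (Commute-sym {L = dᴮ i' p'} {∂B i} (dᴮ-commute-∂ i' p' i)) (prev-commute p)
  where
  prev-commute : ∀ p → Commute (prevᴮ p) (dᴮ i' p')
  prev-commute nothing  = Commute-zeroˡ (dᴮ i' p')
  prev-commute (just j) = Commute-sym {L = dᴮ i' p'} {∂B j} (dᴮ-commute-∂ i' p' j)

d⊗ : ℕ → Maybe ℕ → Lin (ChenB × ChenB) → Lin (ChenB × ChenB)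
d⊗ i p U = (idL⊗ d i p) U +L (d i p ⊗idL) U

pairing-d⊗ : ∀ i p U g → ⟪ d⊗ i p U , g ⟫ ≡ ⟪ U , dual⊗ (dᴮ i p) g ⟫
pairing-d⊗ i p U g = begin
  ⟪ d⊗ i p U , g ⟫                           ≡⟨ pairing-++ ((idL⊗ d i p) U) _ g ⟩
  ⟪ (idL⊗ d i p) U , g ⟫ + ⟪ (d i p ⊗idL) U , g ⟫ ≡⟨ cong₂ _+_ (pairing-ext _ U g) (pairing-ext _ U g) ⟩
  _                                          ≡⟨ sym (pairing-+ U _ _) ⟩
  _                                          ≡⟨ pairing-cong U on-basis ⟩
  ⟪ U , dual⊗ (dᴮ i p) g ⟫                   ∎
  where
  on-basis : ∀ ab → ⟪ (idL ⊗L (λ b → dᴮ i p b)) ab , g ⟫ + ⟪ ((λ a → dᴮ i p a) ⊗L idL) ab , g ⟫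
                    ≡ dual⊗ (dᴮ i p) g ab
  on-basis (a , b) = cong₂ _+_
    (trans (pairing-⊗L idL (dᴮ i p) a b g)
      (solve 1 (λ x → con 1ℚ :* x :+ con 0ℚ := x) refl ⟪ dᴮ i p b , (λ b' → g (a , b')) ⟫))
    (trans (pairing-⊗L (dᴮ i p) idL a b g)
      (pairing-cong (dᴮ i p a) (λ a' → solve 1 (λ x → con 1ℚ :* x :+ con 0ℚ := x) refl (g (a' , b)))))

-- Independence of Δ^ch from the lowered exponent

-- Raise ctx p i e r t: t is r with the stored exponent e at index i raised to suc e, and p is
-- the index preceding i (ctx if i comes first).
data Raise : Maybe ℕ → Maybe ℕ → ℕ → ℕ → ChenB → ChenB → Set where
  here  : ∀ {ctx i e ps} → Raise ctx ctx i e ((i , e) ∷ ps) ((i , suc e) ∷ ps)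
  there : ∀ {ctx p i e a x ps qs} → Raise (just a) p i e ps qs → Raise ctx p i e ((a , x) ∷ ps) ((a , x) ∷ qs)

lowerFirst-sound : ∀ ctx t {p i e r} → lowerFirst ctx t ≡ just (lowered p i e r) → Raise ctx p i e r t
lowerFirst-sound ctx [] ()
lowerFirst-sound ctx ((a , zero) ∷ ps) eq with lowerFirst (just a) ps in eq'
lowerFirst-sound ctx ((a , zero) ∷ ps) () | nothing
lowerFirst-sound ctx ((a , zero) ∷ ps) refl | just (lowered p i s r) = there (lowerFirst-sound (just a) ps eq')
lowerFirst-sound ctx ((a , suc e) ∷ ps) refl = here

lowerFirst-complete : ∀ {ctx p i e r t} → Raise ctx p i e r t → ∃ λ L → lowerFirst ctx t ≡ just L
lowerFirst-complete here = _ , refl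
lowerFirst-complete (there {a = a} {x = zero} {qs = qs} R) with lowerFirst (just a) qs | lowerFirst-complete R
... | just (lowered p i s r) | _ = _ , refl
lowerFirst-complete (there {x = suc x} R) = _ , refl

Raise-sumE : ∀ {ctx p i e r t} → Raise ctx p i e r t → sumE t ≡ suc (sumE r)
Raise-sumE here = refl
Raise-sumE (there {x = x} R) = trans (cong (x ℕ.+_) (Raise-sumE R)) (NP.+-suc x _)

Raise-indices : ∀ {ctx p i e r t} → Raise ctx p i e r t → indices t ≡ indices r
Raise-indices here = refl
Raise-indices (there {a = a} R) = cong (a ∷_) (Raise-indices R)

lastIndex : Maybe ℕ → ChenB → Maybe ℕ
lastIndex ctx [] = ctx
lastIndex ctx ((a , _) ∷ pre) = lastIndex (just a) pre

Raise-++ : ∀ {ctx p i e r t} pre → Raise (lastIndex ctx pre) p i e r t → Raise ctx p i e (pre ++ r) (pre ++ t)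
Raise-++ [] R = R
Raise-++ (_ ∷ pre) R = there (Raise-++ pre R)

Raise-diamond : ∀ {ctx p i e r p' i' e' r' t} → Raise ctx p i e r t → Raise ctx p' i' e' r' t →
  (p ≡ p' × i ≡ i' × e ≡ e' × r ≡ r') ⊎ (∃ λ q → Raise ctx p i e q r' × Raise ctx p' i' e' q r)
Raise-diamond here here = inj₁ (refl , refl , refl , refl)
Raise-diamond here (there R') = inj₂ (_ , here , there R')
Raise-diamond (there R) here = inj₂ (_ , there R , here)
Raise-diamond (there R) (there R') with Raise-diamond R R'
... | inj₁ (refl , refl , refl , refl) = inj₁ (refl , refl , refl , refl)
... | inj₂ (q , R₁ , R₂) = inj₂ (_ , there R₁ , there R₂)

pairing-Δch-step : ∀ e i p U g →
  ⟪ scaleL (+ 1 ℚ./ suc e) (d⊗ i p U) , g ⟫ ≡ (+ 1 ℚ./ suc e) * ⟪ U , dual⊗ (dᴮ i p) g ⟫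
pairing-Δch-step e i p U g =
  trans (pairing-scaleL (+ 1 ℚ./ suc e) (d⊗ i p U) g) (cong ((+ 1 ℚ./ suc e) *_) (pairing-d⊗ i p U g))

Δch-go-lowerFirst : ∀ n t {p i e r} → lowerFirst nothing t ≡ just (lowered p i e r) → ∀ g →
  ⟪ Δch-go (suc n) t , g ⟫ ≡ (+ 1 ℚ./ suc e) * ⟪ Δch-go n r , dual⊗ (dᴮ i p) g ⟫
Δch-go-lowerFirst n t {p} {i} {e} {r} eq g rewrite eq = pairing-Δch-step e i p (Δch-go n r) g

-- Confluence: two lowerings t → r, t → r' are completed by a common q, and the two routes
-- t → r → q, t → r' → q agree because the corresponding d⊗'s commute.
Δch-go-raise : ∀ n {t r p i e} → sumE r ≡ n → Raise nothing p i e r t → ∀ g →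
  ⟪ Δch-go (suc n) t , g ⟫ ≡ (+ 1 ℚ./ suc e) * ⟪ Δch-go n r , dual⊗ (dᴮ i p) g ⟫
Δch-go-raise n {t} {r} {p} {i} {e} sr R g with lowerFirst-complete R
... | (lowered p' i' e' r' , eq) with Raise-diamond R (lowerFirst-sound nothing t eq)
...   | inj₁ (refl , refl , refl , refl) = Δch-go-lowerFirst n t eq g
...   | inj₂ (q , R₁ , R₂) = go n sr
  where
  c  = + 1 ℚ./ suc e
  c' = + 1 ℚ./ suc e'
  go : ∀ n → sumE r ≡ n → ⟪ Δch-go (suc n) t , g ⟫ ≡ c * ⟪ Δch-go n r , dual⊗ (dᴮ i p) g ⟫
  go zero sr with () ← trans (sym (Raise-sumE R₂)) sr
  go (suc m) sr = begin
    ⟪ Δch-go (suc (suc m)) t , g ⟫ ≡⟨ Δch-go-lowerFirst (suc m) t eq g ⟩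
    c' * ⟪ Δch-go (suc m) r' , dual⊗ (dᴮ i' p') g ⟫ ≡⟨ cong (c' *_) (Δch-go-raise m sq R₁ _) ⟩
    c' * (c * ⟪ Δch-go m q , dual⊗ (dᴮ i p) (dual⊗ (dᴮ i' p') g) ⟫)
      ≡⟨ cong (λ v → c' * (c * v)) (pairing-cong (Δch-go m q) (dual⊗-commute (dᴮ i p) (dᴮ i' p') (dᴮ-commute i p i' p') g)) ⟩
    c' * (c * ⟪ Δch-go m q , dual⊗ (dᴮ i' p') (dual⊗ (dᴮ i p) g) ⟫)
      ≡⟨ solve 3 (λ a b x → a :* (b :* x) := b :* (a :* x)) refl c' c _ ⟩
    c * (c' * ⟪ Δch-go m q , dual⊗ (dᴮ i' p') (dual⊗ (dᴮ i p) g) ⟫) ≡⟨ cong (c *_) (sym (Δch-go-raise m sq R₂ _)) ⟩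
    c * ⟪ Δch-go (suc m) r , dual⊗ (dᴮ i p) g ⟫ ∎
    where
    sq : sumE q ≡ m
    sq = NP.suc-injective (trans (sym (Raise-sumE R₂)) sr)

Δch-raise : ∀ {t r p i e} → Raise nothing p i e r t → ∀ g →
  ⟪ Δch t , g ⟫ ≡ (+ 1 ℚ./ suc e) * ⟪ Δch r , dual⊗ (dᴮ i p) g ⟫
Δch-raise {r = r} R g rewrite Raise-sumE R = Δch-go-raise (sumE r) refl R g

-- Δ^ch after ∂_m

suc/1*1/suc : ∀ e v → (+ suc e ℚ./ 1) * ((+ 1 ℚ./ suc e) * v) ≡ v
suc/1*1/suc e v rewrite QP.normalize-coprime {suc e} {0} (Coprime.sym (Coprime.1-coprimeTo (suc e)))
                      | QP.normalize-coprime {1} {e} (Coprime.1-coprimeTo (suc e)) = begin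
  s * (1/s * v) ≡⟨ sym (QP.*-assoc s 1/s v) ⟩
  (s * 1/s) * v ≡⟨ cong (_* v) (QP.*-inverseʳ s) ⟩
  1ℚ * v        ≡⟨ QP.*-identityˡ v ⟩
  v             ∎
  where
  s = mkℚ (+ suc e) 0 (Coprime.sym (Coprime.1-coprimeTo (suc e)))
  1/s = mkℚ (+ 1) e (Coprime.1-coprimeTo (suc e))

lastIndex-∷ʳ : ∀ ctx pre a x → lastIndex ctx (pre ++ (a , x) ∷ []) ≡ just a
lastIndex-∷ʳ ctx [] a x = refl
lastIndex-∷ʳ ctx ((b , _) ∷ pre) a x = lastIndex-∷ʳ (just b) pre a x

dSum : Maybe ℕ → ℕ → ChenB → (ChenB × ChenB → ℚ) → ChenB × ChenB → ℚ
dSum ctx m [] H ab = 0ℚ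
dSum ctx m ((a , x) ∷ ps) H ab = χ (memb m ((a , x) ∷ ps)) * dual⊗ (dᴮ a ctx) H ab + dSum (just a) m ps H ab

pairing-Δch-∂B : ∀ pre ps m H →
  ⟪ ∂B m ps , (λ t → ⟪ Δch (pre ++ t) , H ⟫) ⟫ ≡ ⟪ Δch (pre ++ ps) , dSum (lastIndex nothing pre) m ps H ⟫
pairing-Δch-∂B pre [] m H = sym (pairing-0 (Δch (pre ++ [])))
pairing-Δch-∂B pre ((a , x) ∷ ps) m H = begin
  ⟪ ∂B m ((a , x) ∷ ps) , G ⟫ ≡⟨ ∂ᵀ-∷ m G a x ps ⟩
  χm * (s * G ((a , suc x) ∷ ps)) + ⟪ ∂B m ps , (λ t → G ((a , x) ∷ t)) ⟫
    ≡⟨ cong₂ (λ u v → χm * (s * u) + v) (Δch-raise (Raise-++ pre here) H) later ⟩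
  χm * (s * ((+ 1 ℚ./ suc x) * V)) + W ≡⟨ cong (λ u → χm * u + W) (suc/1*1/suc x V) ⟩
  χm * V + W                          ≡⟨ cong (_+ W) (sym (pairing-* Φ χm _)) ⟩
  _                                   ≡⟨ sym (pairing-+ Φ _ _) ⟩
  ⟪ Φ , dSum (lastIndex nothing pre) m ((a , x) ∷ ps) H ⟫ ∎
  where
  G = λ t → ⟪ Δch (pre ++ t) , H ⟫
  Φ = Δch (pre ++ (a , x) ∷ ps)
  χm = χ (memb m ((a , x) ∷ ps))
  s = + suc x ℚ./ 1
  V = ⟪ Φ , dual⊗ (dᴮ a (lastIndex nothing pre)) H ⟫
  W = ⟪ Φ , dSum (just a) m ps H ⟫
  pre' = pre ++ (a , x) ∷ []
  later : ⟪ ∂B m ps , (λ t → G ((a , x) ∷ t)) ⟫ ≡ W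
  later = begin
    ⟪ ∂B m ps , (λ t → G ((a , x) ∷ t)) ⟫
      ≡⟨ pairing-cong (∂B m ps) (λ t → cong (λ l → ⟪ Δch l , H ⟫) (sym (LP.++-assoc pre ((a , x) ∷ []) t))) ⟩
    ⟪ ∂B m ps , (λ t → ⟪ Δch (pre' ++ t) , H ⟫) ⟫ ≡⟨ pairing-Δch-∂B pre' ps m H ⟩
    ⟪ Δch (pre' ++ ps) , dSum (lastIndex nothing pre') m ps H ⟫
      ≡⟨ cong₂ (λ l c → ⟪ Δch l , dSum c m ps H ⟫) (LP.++-assoc pre ((a , x) ∷ []) ps) (lastIndex-∷ʳ nothing pre a x) ⟩
    W ∎

AgreeOnSplittings : ChenB → (ChenB × ChenB → ℚ) → (ChenB × ChenB → ℚ) → Set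
AgreeOnSplittings ps h h' = ∀ a b → indices a ++ indices b ≡ indices ps → h (a , b) ≡ h' (a , b)

pairing-deconc-cong : ∀ ps {h h'} → AgreeOnSplittings ps h h' → ⟪ deconc ps , h ⟫ ≡ ⟪ deconc ps , h' ⟫
pairing-deconc-cong [] agree = cong (λ u → 1ℚ * u + 0ℚ) (agree [] [] refl)
pairing-deconc-cong (q ∷ ps) {h} {h'} agree = cong₂ (λ u v → 1ℚ * u + v) (agree [] (q ∷ ps) refl) (begin
  ⟪ map (λ r → (proj₁ r , q∷ˡ (proj₂ r))) (deconc ps) , h ⟫ ≡⟨ pairing-map q∷ˡ (deconc ps) h ⟩
  ⟪ deconc ps , h ∘ q∷ˡ ⟫                                    ≡⟨ pairing-deconc-cong ps agree-tail ⟩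
  ⟪ deconc ps , h' ∘ q∷ˡ ⟫                                   ≡⟨ sym (pairing-map q∷ˡ (deconc ps) h') ⟩
  ⟪ map (λ r → (proj₁ r , q∷ˡ (proj₂ r))) (deconc ps) , h' ⟫ ∎)
  where
  q∷ˡ : ChenB × ChenB → ChenB × ChenB
  q∷ˡ (a , b) = (q ∷ a , b)
  agree-tail : AgreeOnSplittings ps (h ∘ q∷ˡ) (h' ∘ q∷ˡ)
  agree-tail a b split = agree (q ∷ a) b (cong (proj₁ q ∷_) split)

dual-dᴮ-cong-indices : ∀ i p x {k k'} → (∀ y → indices y ≡ indices x → k y ≡ k' y) →
  dual (dᴮ i p) k x ≡ dual (dᴮ i p) k' x
dual-dᴮ-cong-indices i p x {k} {k'} e =
  trans (dual-dᴮ i p k x) (trans (cong₂ _-_ (∂ᵀ-cong-indices i x e) (prev-cong p)) (sym (dual-dᴮ i p k' x)))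
  where
  prev-cong : ∀ p → dual (prevᴮ p) k x ≡ dual (prevᴮ p) k' x
  prev-cong nothing  = refl
  prev-cong (just j) = ∂ᵀ-cong-indices j x e

dual⊗-dᴮ-agree : ∀ i p ps {h h'} → AgreeOnSplittings ps h h' →
  AgreeOnSplittings ps (dual⊗ (dᴮ i p) h) (dual⊗ (dᴮ i p) h')
dual⊗-dᴮ-agree i p ps agree a b split = cong₂ _+_
  (dual-dᴮ-cong-indices i p b (λ y ey → agree a y (trans (cong (indices a ++_) ey) split)))
  (dual-dᴮ-cong-indices i p a (λ y ey → agree y b (trans (cong (_++ indices b) ey) split)))

Δch-go-cong : ∀ n ps {h h'} → AgreeOnSplittings ps h h' → ⟪ Δch-go n ps , h ⟫ ≡ ⟪ Δch-go n ps , h' ⟫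
Δch-go-cong zero ps agree = pairing-deconc-cong ps agree
Δch-go-cong (suc n) ps {h} {h'} agree with lowerFirst nothing ps in eq
... | nothing = pairing-deconc-cong ps agree
... | just (lowered p i e r) = begin
  ⟪ scaleL c (d⊗ i p (Δch-go n r)) , h ⟫  ≡⟨ pairing-Δch-step e i p (Δch-go n r) h ⟩
  c * ⟪ Δch-go n r , dual⊗ (dᴮ i p) h ⟫   ≡⟨ cong (c *_) (Δch-go-cong n r (dual⊗-dᴮ-agree i p r agree-r)) ⟩
  c * ⟪ Δch-go n r , dual⊗ (dᴮ i p) h' ⟫  ≡⟨ sym (pairing-Δch-step e i p (Δch-go n r) h') ⟩
  ⟪ scaleL c (d⊗ i p (Δch-go n r)) , h' ⟫ ∎
  where
  c = + 1 ℚ./ suc e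
  agree-r : AgreeOnSplittings r h h'
  agree-r a b split = agree a b (trans split (sym (Raise-indices (lowerFirst-sound nothing ps eq))))

-- Chen fractions with indices 1, …, k

label : ℕ → List ℕ → ChenB
label o [] = []
label o (e ∷ es) = (suc o , e) ∷ label (suc o) es

range : ℕ → ℕ → List ℕ
range o zero = []
range o (suc n) = suc o ∷ range (suc o) n

zip-applyUpTo≡label : ∀ o (f : ℕ → ℕ) es → (∀ i → f i ≡ o ℕ.+ i) →
  zip (map suc (applyUpTo f (length es))) es ≡ label o es
zip-applyUpTo≡label o f [] _ = refl
zip-applyUpTo≡label o f (e ∷ es) f≗o+ = cong₂ _∷_
  (cong (λ n → (suc n , e)) (trans (f≗o+ 0) (NP.+-identityʳ o)))
  (zip-applyUpTo≡label (suc o) (f ∘ suc) es (λ i → trans (f≗o+ (suc i)) (NP.+-suc o i)))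

πB-label : ∀ o es → πB (label o es) ≡ es
πB-label o [] = refl
πB-label o (e ∷ es) = cong (e ∷_) (πB-label (suc o) es)

indices-label : ∀ o es → indices (label o es) ≡ range o (length es)
indices-label o [] = refl
indices-label o (e ∷ es) = cong (suc o ∷_) (indices-label (suc o) es)

length-range : ∀ o n → length (range o n) ≡ n
length-range o zero = refl
length-range o (suc n) = cong suc (length-range (suc o) n)

++≡range : ∀ o n xs ys → xs ++ ys ≡ range o n →
  xs ≡ range o (length xs) × ys ≡ range (o ℕ.+ length xs) (length ys)
++≡range o n [] ys eq =
  refl , trans eq (cong₂ range (sym (NP.+-identityʳ o)) (sym (trans (cong length eq) (length-range o n))))
++≡range o zero (x ∷ xs) ys ()
++≡range o (suc n) (x ∷ xs) ys eq with LP.∷-injective eq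
... | refl , eq' with ++≡range (suc o) n xs ys eq'
...   | xs≡ , ys≡ = cong (suc o ∷_) xs≡ , trans ys≡ (cong (λ z → range z (length ys)) (sym (NP.+-suc o (length xs))))

label-πB : ∀ o a → indices a ≡ range o (length a) → a ≡ label o (πB a)
label-πB o [] eq = refl
label-πB o ((x , e) ∷ a) eq with LP.∷-injective eq
... | refl , eq' = cong ((suc o , e) ∷_) (label-πB (suc o) a eq')

memb-here : ∀ a e ps → memb a ((a , e) ∷ ps) ≡ true
memb-here a e ps = cong (λ b → if b then true else memb a ps) (dec-true (a ℕ.≟ a) refl)

memb-there : ∀ {i a} e ps → i ≢ a → memb i ((a , e) ∷ ps) ≡ memb i ps
memb-there {i} {a} e ps i≢a = cong (λ b → if b then true else memb i ps) (dec-false (i ℕ.≟ a) i≢a)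

memb-++-false : ∀ i ps qs → memb i (ps ++ qs) ≡ false → memb i ps ≡ false × memb i qs ≡ false
memb-++-false i [] qs eq = refl , eq
memb-++-false i ((a , e) ∷ ps) qs eq with i ℕ.≟ a
... | yes refl = case trans (sym (memb-here a e (ps ++ qs))) eq of λ ()
... | no i≢a   with memb-++-false i ps qs (trans (sym (memb-there e (ps ++ qs) i≢a)) eq)
...   | ps-false , qs-false = trans (memb-there e ps i≢a) ps-false , qs-false

memb-label-≤ : ∀ m o es → m ℕ.≤ o → memb m (label o es) ≡ false
memb-label-≤ m o [] m≤o = refl
memb-label-≤ m o (e ∷ es) m≤o =
  trans (memb-there e (label (suc o) es) (NP.<⇒≢ (ℕ.s≤s m≤o))) (memb-label-≤ m (suc o) es (NP.m≤n⇒m≤1+n m≤o))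

memb-label : ∀ o n es → memb (suc (o ℕ.+ n)) (label o es) ≡ does (n ℕ.<? length es)
memb-label o n [] = refl
memb-label o zero (e ∷ es) rewrite NP.+-identityʳ o = memb-here (suc o) e (label (suc o) es)
memb-label o (suc k) (e ∷ es) = begin
  memb (suc (o ℕ.+ suc k)) (label o (e ∷ es)) ≡⟨ memb-there e (label (suc o) es) (NP.m+1+n≢m o ∘ NP.suc-injective) ⟩
  memb (suc (o ℕ.+ suc k)) (label (suc o) es) ≡⟨ cong (λ z → memb (suc z) (label (suc o) es)) (NP.+-suc o k) ⟩
  memb (suc (suc o ℕ.+ k)) (label (suc o) es) ≡⟨ memb-label (suc o) k es ⟩
  does (k ℕ.<? length es)                     ∎

∂B-absent : ∀ m ps → memb m ps ≡ false → ∂B m ps ≡ []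
∂B-absent m [] _ = refl
∂B-absent m ((a , x) ∷ ps) absent
  rewrite absent | ∂B-absent m ps (proj₂ (memb-++-false m ((a , x) ∷ []) ps absent)) = refl

does-≤?-suc : ∀ n m → does (suc n ℕ.≤? suc m) ≡ does (n ℕ.≤? m)
does-≤?-suc zero    m = refl
does-≤?-suc (suc n) m = refl

mapL-label-∷ : ∀ o e (u : 𝓗) →
  map (λ p → (proj₁ p , (suc o , e) ∷ proj₂ p)) (mapL (label (suc o)) u) ≡ mapL (label o) (map (λ q → (proj₁ q , e ∷ proj₂ q)) u)
mapL-label-∷ o e [] = refl
mapL-label-∷ o e ((c , s) ∷ u) = cong ((c , (suc o , e) ∷ label (suc o) s) ∷_) (mapL-label-∷ o e u)

∂B-label : ∀ o n es → ∂B (o ℕ.+ n) (label o es) ≡ mapL (label o) (δℕB n es)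
∂B-label o zero [] = refl
∂B-label o (suc n) [] = refl
∂B-label o zero (e ∷ es) =
  ∂B-absent (o ℕ.+ 0) (label o (e ∷ es)) (memb-label-≤ _ o (e ∷ es) (NP.≤-reflexive (NP.+-identityʳ o)))
∂B-label o (suc n) (e ∷ es) rewrite NP.+-suc o n = begin
  raisedHead (memb (suc (o ℕ.+ n)) (label o (e ∷ es))) ++ consTail (∂B (suc o ℕ.+ n) (label (suc o) es))
    ≡⟨ cong₂ (λ b u → raisedHead b ++ consTail u)
             (trans (memb-label o n (e ∷ es)) (does-≤?-suc n (length es))) (∂B-label (suc o) n es) ⟩
  raisedHead b ++ consTail (mapL (label (suc o)) (if b then δℕ-sum n es else []))
    ≡⟨ by-cases b ⟩
  mapL (label o) (if b then δℕ-sum (suc n) (e ∷ es) else [])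
    ≡⟨ cong (λ b → mapL (label o) (if b then δℕ-sum (suc n) (e ∷ es) else [])) (sym (does-≤?-suc n (length es))) ⟩
  mapL (label o) (δℕB (suc n) (e ∷ es)) ∎
  where
  b = does (n ℕ.≤? length es)
  raisedHead : Bool → Lin ChenB
  raisedHead b = if b then ((+ suc e ℚ./ 1) , ((suc o , suc e) ∷ label (suc o) es)) ∷ [] else []
  consTail : Lin ChenB → Lin ChenB
  consTail = map (λ p → (proj₁ p , (suc o , e) ∷ proj₂ p))
  by-cases : ∀ b → raisedHead b ++ consTail (mapL (label (suc o)) (if b then δℕ-sum n es else []))
                   ≡ mapL (label o) (if b then δℕ-sum (suc n) (e ∷ es) else [])
  by-cases true  = cong (((+ suc e ℚ./ 1) , ((suc o , suc e) ∷ label (suc o) es)) ∷_) (mapL-label-∷ o e (δℕ-sum n es))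
  by-cases false = refl

δB-neg : ∀ k es → δB (ℤ.- (+ k)) es ≡ []
δB-neg zero    es = refl
δB-neg (suc k) es = refl

pairing-∂B-label : ∀ j m es (h : HB → ℚ) → ⟪ ∂B m (label j es) , h ∘ πB ⟫ ≡ ⟪ δB (+ m ℤ.- + j) es , h ⟫
pairing-∂B-label j m es h with m ℕ.≤? j
... | yes m≤j = begin
  ⟪ ∂B m (label j es) , h ∘ πB ⟫ ≡⟨ cong (λ u → ⟪ u , h ∘ πB ⟫) (∂B-absent m (label j es) (memb-label-≤ m j es m≤j)) ⟩
  0ℚ                             ≡⟨ cong (λ u → ⟪ u , h ⟫) (sym (δB-neg (j ℕ.∸ m) es)) ⟩
  ⟪ δB (ℤ.- + (j ℕ.∸ m)) es , h ⟫ ≡⟨ cong (λ i → ⟪ δB i es , h ⟫) (sym (trans (ZP.[+m]-[+n]≡m⊖n m j) (ZP.⊖-≤ m≤j))) ⟩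
  ⟪ δB (+ m ℤ.- + j) es , h ⟫    ∎
... | no m≰j = begin
  ⟪ ∂B m (label j es) , h ∘ πB ⟫ ≡⟨ cong (λ z → ⟪ ∂B z (label j es) , h ∘ πB ⟫) (sym (NP.m+[n∸m]≡n j≤m)) ⟩
  ⟪ ∂B (j ℕ.+ (m ℕ.∸ j)) (label j es) , h ∘ πB ⟫ ≡⟨ cong (λ u → ⟪ u , h ∘ πB ⟫) (∂B-label j (m ℕ.∸ j) es) ⟩
  ⟪ mapL (label j) (δℕB (m ℕ.∸ j) es) , h ∘ πB ⟫ ≡⟨ pairing-map (label j) (δℕB (m ℕ.∸ j) es) (h ∘ πB) ⟩
  ⟪ δℕB (m ℕ.∸ j) es , h ∘ πB ∘ label j ⟫        ≡⟨ pairing-cong (δℕB (m ℕ.∸ j) es) (λ s → cong h (πB-label j s)) ⟩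
  ⟪ δB (+ (m ℕ.∸ j)) es , h ⟫ ≡⟨ cong (λ i → ⟪ δB i es , h ⟫) (sym (trans (ZP.[+m]-[+n]≡m⊖n m j) (ZP.⊖-≥ j≤m))) ⟩
  ⟪ δB (+ m ℤ.- + j) es , h ⟫ ∎
  where
  j≤m = NP.<⇒≤ (NP.≰⇒> m≰j)

∂⊗ : ℕ → (ChenB × ChenB → ℚ) → ChenB × ChenB → ℚ
∂⊗ m = dual⊗ (∂B m)

dual⊗-dᴮ : ∀ i p g ab → dual⊗ (dᴮ i p) g ab ≡ ∂⊗ i g ab - dual⊗ (prevᴮ p) g ab
dual⊗-dᴮ i p = dual⊗-difference {L = dᴮ i p} {∂B i} {prevᴮ p} (dual-dᴮ i p)

dSum-label : ∀ o es ctx m H ab →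
  dSum ctx m (label o es) H ab ≡ χ (memb m (label o es)) * (∂⊗ m H ab - dual⊗ (prevᴮ ctx) H ab)
dSum-label o [] ctx m H ab = sym (QP.*-zeroˡ (∂⊗ m H ab - dual⊗ (prevᴮ ctx) H ab))
dSum-label o (e ∷ es) ctx m H ab = begin
  χM * dual⊗ (dᴮ (suc o) ctx) H ab + dSum (just (suc o)) m rest H ab
    ≡⟨ cong₂ (λ u v → χM * u + v) (dual⊗-dᴮ (suc o) ctx H ab)
                                   (dSum-label (suc o) es (just (suc o)) m H ab) ⟩
  χM * (E - P) + χr * (Em - E) ≡⟨ telescope (m ℕ.≟ suc o) ⟩
  χM * (Em - P)                ∎
  where
  rest = label (suc o) es
  χM = χ (memb m ((suc o , e) ∷ rest))
  χr = χ (memb m rest)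
  E  = ∂⊗ (suc o) H ab
  Em = ∂⊗ m H ab
  P  = dual⊗ (prevᴮ ctx) H ab
  telescope : Dec (m ≡ suc o) → χM * (E - P) + χr * (Em - E) ≡ χM * (Em - P)
  telescope (yes m≡) = begin
    χM * (E - P) + χr * (Em - E) ≡⟨ cong (λ k → χM * (E - P) + χr * (∂⊗ k H ab - E)) m≡ ⟩
    χM * (E - P) + χr * (E - E)  ≡⟨ solve 4 (λ a b x y → a :* (x :- y) :+ b :* (x :- x) := a :* (x :- y)) refl χM χr E P ⟩
    χM * (E - P)                 ≡⟨ cong (λ k → χM * (∂⊗ k H ab - P)) (sym m≡) ⟩
    χM * (Em - P)                ∎
  telescope (no m≢) = begin
    χM * (E - P) + χr * (Em - E) ≡⟨ cong (λ b → χ b * (E - P) + χr * (Em - E)) (memb-there e rest m≢) ⟩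
    χr * (E - P) + χr * (Em - E) ≡⟨ solve 4 (λ a x y z → a :* (x :- y) :+ a :* (z :- x) := a :* (z :- y)) refl χr E P Em ⟩
    χr * (Em - P)                ≡⟨ cong (λ b → χ b * (Em - P)) (sym (memb-there e rest m≢)) ⟩
    χM * (Em - P)                ∎

-- Passing to 𝓗

ππ : ChenB × ChenB → HB × HB
ππ (a , b) = (πB a , πB b)

pairing-ΔdescB : ∀ es g → ⟪ ΔdescB es , g ⟫ ≡ ⟪ Δch (label 0 es) , g ∘ ππ ⟫
pairing-ΔdescB es g = trans (pairing-map ππ (Δch (zip (map suc (upTo (length es))) es)) g)
  (cong (λ l → ⟪ Δch l , g ∘ ππ ⟫) (zip-applyUpTo≡label 0 (λ i → i) es (λ i → refl)))

id⊙δᵀ : ℤ → (HB × HB → ℚ) → HB × HB → ℚ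
id⊙δᵀ i g (s , t) = ⟪ δB (i ℤ.- + dep s) t , (λ t' → g (s , t')) ⟫

δ⊗idᵀ : ℤ → (HB × HB → ℚ) → HB × HB → ℚ
δ⊗idᵀ i g (s , t) = ⟪ δB i s , (λ s' → g (s' , t)) ⟫

pairing-id⊙δ : ∀ i U g → ⟪ id⊙δ i U , g ⟫ ≡ ⟪ U , id⊙δᵀ i g ⟫
pairing-id⊙δ i U g = trans (pairing-ext _ U g)
  (pairing-cong U (λ st → pairing-map (proj₁ st ,_) (δB (i ℤ.- + dep (proj₁ st)) (proj₂ st)) g))

pairing-δ⊗id : ∀ i U g → ⟪ δ⊗id i U , g ⟫ ≡ ⟪ U , δ⊗idᵀ i g ⟫
pairing-δ⊗id i U g = trans (pairing-ext _ U g)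
  (pairing-cong U (λ st → pairing-map (_, proj₂ st) (δB i (proj₁ st)) g))

δB-negsuc-shift : ∀ n k es → δB (-[1+ n ] ℤ.- + k) es ≡ []
δB-negsuc-shift n zero    es = refl
δB-negsuc-shift n (suc k) es = refl

∂⊗-absent : ∀ m ps H a b → indices a ++ indices b ≡ indices ps → memb m ps ≡ false → ∂⊗ m H (a , b) ≡ 0ℚ
∂⊗-absent m ps H a b split absent = begin
  ∂⊗ m H (a , b) ≡⟨ cong₂ (λ u v → ⟪ u , (λ b' → H (a , b')) ⟫ + ⟪ v , (λ a' → H (a' , b)) ⟫)
                          (∂B-absent m b (proj₂ a,b-absent)) (∂B-absent m a (proj₁ a,b-absent)) ⟩
  0ℚ + 0ℚ        ≡⟨ QP.+-identityˡ 0ℚ ⟩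
  0ℚ             ∎
  where
  a,b-absent = memb-++-false m a b
    (trans (memb-cong-indices m {a ++ b} {ps} (trans (LP.map-++ proj₁ a b) split)) absent)

∂⊗-label-splitting : ∀ m es g a b → indices a ++ indices b ≡ indices (label 0 es) →
  ∂⊗ m (g ∘ ππ) (a , b) ≡ id⊙δᵀ (+ m) g (ππ (a , b)) + δ⊗idᵀ (+ m) g (ππ (a , b))
∂⊗-label-splitting m es g a b split = cong₂ _+_ right left
  where
  ranges = ++≡range 0 (length es) (indices a) (indices b) (trans split (indices-label 0 es))
  length-a : length (indices a) ≡ length a
  length-a = LP.length-map proj₁ a
  a≡ : a ≡ label 0 (πB a)
  a≡ = label-πB 0 a (trans (proj₁ ranges) (cong (range 0) length-a))
  b≡ : b ≡ label (length a) (πB b)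
  b≡ = label-πB (length a) b (trans (proj₂ ranges) (cong₂ range length-a (LP.length-map proj₁ b)))
  right : dual (∂B m) (λ b' → g (πB a , πB b')) b ≡ id⊙δᵀ (+ m) g (ππ (a , b))
  right = begin
    ⟪ ∂B m b , (λ b' → g (πB a , πB b')) ⟫
      ≡⟨ cong (λ z → ⟪ ∂B m z , (λ b' → g (πB a , πB b')) ⟫) b≡ ⟩
    ⟪ ∂B m (label (length a) (πB b)) , (λ b' → g (πB a , πB b')) ⟫
      ≡⟨ pairing-∂B-label (length a) m (πB b) (λ t → g (πB a , t)) ⟩
    ⟪ δB (+ m ℤ.- + length a) (πB b) , (λ t → g (πB a , t)) ⟫
      ≡⟨ cong (λ n → ⟪ δB (+ m ℤ.- + n) (πB b) , (λ t → g (πB a , t)) ⟫) (sym (LP.length-map proj₂ a)) ⟩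
    id⊙δᵀ (+ m) g (ππ (a , b)) ∎
  left : dual (∂B m) (λ a' → g (πB a' , πB b)) a ≡ δ⊗idᵀ (+ m) g (ππ (a , b))
  left = begin
    ⟪ ∂B m a , (λ a' → g (πB a' , πB b)) ⟫
      ≡⟨ cong (λ z → ⟪ ∂B m z , (λ a' → g (πB a' , πB b)) ⟫) a≡ ⟩
    ⟪ ∂B m (label 0 (πB a)) , (λ a' → g (πB a' , πB b)) ⟫
      ≡⟨ pairing-∂B-label 0 m (πB a) (λ s → g (s , πB b)) ⟩
    ⟪ δB (+ m ℤ.- + 0) (πB a) , (λ s → g (s , πB b)) ⟫
      ≡⟨ cong (λ i → ⟪ δB i (πB a) , (λ s → g (s , πB b)) ⟫) (ZP.+-identityʳ (+ m)) ⟩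
    δ⊗idᵀ (+ m) g (ππ (a , b)) ∎

Δdesc-δ-basis : ∀ i es g →
  ⟪ δB i es , (λ es' → ⟪ ΔdescB es' , g ⟫) ⟫ ≡ ⟪ ΔdescB es , (λ st → id⊙δᵀ i g st + δ⊗idᵀ i g st) ⟫
Δdesc-δ-basis (+ m) es g = begin
  ⟪ δℕB m es , (λ es' → ⟪ ΔdescB es' , g ⟫) ⟫          ≡⟨ pairing-cong (δℕB m es) (λ es' → pairing-ΔdescB es' g) ⟩
  ⟪ δℕB m es , (λ es' → ⟪ Δch (label 0 es') , H ⟫) ⟫   ≡⟨ sym (pairing-map (label 0) (δℕB m es) (λ t → ⟪ Δch t , H ⟫)) ⟩
  ⟪ mapL (label 0) (δℕB m es) , (λ t → ⟪ Δch t , H ⟫) ⟫ ≡⟨ cong (λ u → ⟪ u , (λ t → ⟪ Δch t , H ⟫) ⟫) (sym (∂B-label 0 m es)) ⟩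
  ⟪ ∂B m Φ , (λ t → ⟪ Δch t , H ⟫) ⟫                    ≡⟨ pairing-Δch-∂B [] Φ m H ⟩
  ⟪ Δch Φ , dSum nothing m Φ H ⟫                        ≡⟨ pairing-cong (Δch Φ) (dSum-label 0 es nothing m H) ⟩
  ⟪ Δch Φ , (λ ab → χ (memb m Φ) * (∂⊗ m H ab - dual⊗ (prevᴮ nothing) H ab)) ⟫ ≡⟨ Δch-go-cong (sumE Φ) Φ agree ⟩
  ⟪ Δch Φ , (λ ab → id⊙δᵀ (+ m) g (ππ ab) + δ⊗idᵀ (+ m) g (ππ ab)) ⟫ ≡⟨ sym (pairing-ΔdescB es _) ⟩
  ⟪ ΔdescB es , (λ st → id⊙δᵀ (+ m) g st + δ⊗idᵀ (+ m) g st) ⟫ ∎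
  where
  Φ = label 0 es
  H = g ∘ ππ
  agree : AgreeOnSplittings Φ (λ ab → χ (memb m Φ) * (∂⊗ m H ab - dual⊗ (prevᴮ nothing) H ab))
                              (λ ab → id⊙δᵀ (+ m) g (ππ ab) + δ⊗idᵀ (+ m) g (ππ ab))
  agree a b split with memb m Φ in absent
  ... | true  = trans (solve 1 (λ E → con 1ℚ :* (E :- (con 0ℚ :+ con 0ℚ)) := E) refl (∂⊗ m H (a , b)))
                      (∂⊗-label-splitting m es g a b split)
  ... | false = trans (solve 1 (λ E → con 0ℚ :* (E :- (con 0ℚ :+ con 0ℚ)) := con 0ℚ) refl (∂⊗ m H (a , b)))
                      (trans (sym (∂⊗-absent m Φ H a b split absent)) (∂⊗-label-splitting m es g a b split))
Δdesc-δ-basis -[1+ n ] es g = sym (trans (pairing-cong (ΔdescB es) vanish) (pairing-0 (ΔdescB es)))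
  where
  vanish : ∀ st → id⊙δᵀ -[1+ n ] g st + δ⊗idᵀ -[1+ n ] g st ≡ 0ℚ
  vanish (s , t) rewrite δB-negsuc-shift n (dep s) t = QP.+-identityˡ 0ℚ

Δdesc-δ-≋ : ∀ i x → Δdesc (δ i x) ≋ (id⊙δ i (Δdesc x) +L δ⊗id i (Δdesc x))
Δdesc-δ-≋ i x g = begin
  ⟪ Δdesc (δ i x) , g ⟫                                       ≡⟨ pairing-ext ΔdescB (δ i x) g ⟩
  ⟪ δ i x , (λ es' → ⟪ ΔdescB es' , g ⟫) ⟫                    ≡⟨ pairing-ext (δB i) x _ ⟩
  ⟪ x , (λ es → ⟪ δB i es , (λ es' → ⟪ ΔdescB es' , g ⟫) ⟫) ⟫
    ≡⟨ pairing-cong x (λ es → trans (Δdesc-δ-basis i es g) (pairing-+ (ΔdescB es) _ _)) ⟩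
  ⟪ x , (λ es → ⟪ ΔdescB es , id⊙δᵀ i g ⟫ + ⟪ ΔdescB es , δ⊗idᵀ i g ⟫) ⟫
    ≡⟨ pairing-+ x _ _ ⟩
  ⟪ x , (λ es → ⟪ ΔdescB es , id⊙δᵀ i g ⟫) ⟫ + ⟪ x , (λ es → ⟪ ΔdescB es , δ⊗idᵀ i g ⟫) ⟫
    ≡⟨ sym (cong₂ _+_ (pairing-ext ΔdescB x _) (pairing-ext ΔdescB x _)) ⟩
  ⟪ Δdesc x , id⊙δᵀ i g ⟫ + ⟪ Δdesc x , δ⊗idᵀ i g ⟫
    ≡⟨ sym (cong₂ _+_ (pairing-id⊙δ i (Δdesc x) g) (pairing-δ⊗id i (Δdesc x) g)) ⟩
  ⟪ id⊙δ i (Δdesc x) , g ⟫ + ⟪ δ⊗id i (Δdesc x) , g ⟫        ≡⟨ sym (pairing-++ (id⊙δ i (Δdesc x)) _ g) ⟩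
  ⟪ id⊙δ i (Δdesc x) +L δ⊗id i (Δdesc x) , g ⟫               ∎

lemma4p11 : (i : ℤ) (x : 𝓗) →
    Δdesc (δ i x) ≈⟨ HB2-≟ ⟩ (id⊙δ i (Δdesc x) +L δ⊗id i (Δdesc x))
lemma4p11 i x = ≋⇒≈ HB2-≟ {Δdesc (δ i x)} {id⊙δ i (Δdesc x) +L δ⊗id i (Δdesc x)} (Δdesc-δ-≋ i x)
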